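{- Let $L_1$, $L_2$, $P$ be complete lattices and let $(\&,\swarrow,\nwarrow)$ be an adjoint triple with respect to $L_1,L_2,P$. Then the following data define a non-trivial quantaloid $\mathcal{Q}_{\&}$: (i) objects: $-1,0,1$; (ii) hom-sets: $\mathcal{Q}_{\&}(-1,0)=L_1$, $\mathcal{Q}_{\&}(0,1)=L_2$, $\mathcal{Q}_{\&}(-1,1)=P$; $\mathcal{Q}_{\&}(i,i)=\{\bot_{i,i},\mathrm{id}_i\}$ (a two-element chain $\bot_{i,i}<\mathrm{id}_i$) for $i=-1,0,1$; and $\mathcal{Q}_{\&}(i,j)=\{\bot_{i,j}\}$ (one element) whenever $-1\le j<i\le 1$; (iii) composition: $v\circ u=u\,\&\,v$ for $u\in\mathcal{Q}_{\&}(-1,0)=L_1$, $v\in\mathcal{Q}_{\&}(0,1)=L_2$; composition with an identity $\mathrm{id}_i$ is given by the identity law, and all other composites are the bottom element of the relevant hom-set. Moreover, the left and right implications of $\mathcal{Q}_{\&}$ satisfy $w/u=w\nwarrow u$ and $v\backslash w=w\swarrow v$ for all $u\in L_1$, $v\in L_2$, $w\in P$ (all other implications being determined trivially).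
   Context: An adjoint triple $(\&,\swarrow,\nwarrow)$ with respect to complete lattices $L_1,L_2,P$ consists of maps $\&:L_1\times L_2\to P$, $\swarrow:P\times L_2\to L_1$, $\nwarrow:P\times L_1\to L_2$ such that $x\,\&\,y\le z\iff x\le z\swarrow y\iff y\le z\nwarrow x$ for all $x\in L_1$, $y\in L_2$, $z\in P$ (equivalently, $\&$ preserves arbitrary joins in each variable and $\swarrow,\nwarrow$ are the induced right adjoints). A quantaloid is a category whose hom-sets are complete lattices and whose composition preserves arbitrary joins in each variable. For $u\in\mathcal{Q}(p,q)$, $v\in\mathcal{Q}(q,r)$, $w\in\mathcal{Q}(p,r)$ the left implication $w/u\in\mathcal{Q}(q,r)$ and right implication $v\backslash w\in\mathcal{Q}(p,q)$ are defined by $v\circ u\le w\iff v\le w/u\iff u\le v\backslash w$. A quantaloid is non-trivial if $\bot_{q,q}<\mathrm{id}_q$ for every object $q$, where $\bot_{p,q}$ denotes the bottom of $\mathcal{Q}(p,q)$. -}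

module Defs where

open import Data.Empty using (⊥; ⊥-elim)
open import Data.Unit using (⊤; tt)
open import Data.Product using (Σ; _×_; _,_)
open import Relation.Nullary using (¬_)
open import Relation.Binary.PropositionalEquality using (_≡_)
open import Relation.Binary.Structures using (IsPartialOrder)
open import Function.Bundles using (_⇔_)

record CompleteLattice : Set₁ where
  infix 4 _≤_
  field
    Carrier        : Set
    _≤_            : Carrier → Carrier → Set
    isPartialOrder : IsPartialOrder _≡_ _≤_
    ⋁              : {I : Set} → (I → Carrier) → Carrier
    ⋁-upper        : {I : Set} (f : I → Carrier) (i : I) → f i ≤ ⋁ f
    ⋁-least        : {I : Set} (f : I → Carrier) (x : Carrier) →
                     ((i : I) → f i ≤ x) → ⋁ f ≤ x

  bot : Carrier
  bot = ⋁ {⊥} ⊥-elim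

open CompleteLattice using (Carrier; bot) public

record AdjointTriple (L₁ L₂ P : CompleteLattice) : Set where
  private
    module L₁ = CompleteLattice L₁
    module L₂ = CompleteLattice L₂
    module P  = CompleteLattice P
  field
    _&_  : L₁.Carrier → L₂.Carrier → P.Carrier
    _↙_  : P.Carrier → L₂.Carrier → L₁.Carrier
    _↖_  : P.Carrier → L₁.Carrier → L₂.Carrier
    adj↙ : (x : L₁.Carrier) (y : L₂.Carrier) (z : P.Carrier) →
           (x & y P.≤ z) ⇔ (x L₁.≤ z ↙ y)
    adj↖ : (x : L₁.Carrier) (y : L₂.Carrier) (z : P.Carrier) →
           (x & y P.≤ z) ⇔ (y L₂.≤ z ↖ x)

record QuantaloidData : Set₁ where
  field
    Obj  : Set
    Hom  : Obj → Obj → Set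
    _≤_  : {p q : Obj} → Hom p q → Hom p q → Set
    id   : (q : Obj) → Hom q q
    _∘_  : {p q r : Obj} → Hom q r → Hom p q → Hom p r

module _ (D : QuantaloidData) where
  open QuantaloidData D

  IsLUB : {p q : Obj} {I : Set} → (I → Hom p q) → Hom p q → Set
  IsLUB {I = I} f x =
    ((i : I) → f i ≤ x) × ((y : _) → ((i : I) → f i ≤ y) → x ≤ y)

  record IsQuantaloid : Set₁ where
    field
      hom-partialOrder : (p q : Obj) → IsPartialOrder (_≡_ {A = Hom p q}) _≤_
      hom-complete     : (p q : Obj) {I : Set} (f : I → Hom p q) →
                         Σ (Hom p q) (IsLUB f)
      identityˡ        : (p q : Obj) (u : Hom p q) → id q ∘ u ≡ u
      identityʳ        : (p q : Obj) (u : Hom p q) → u ∘ id p ≡ u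
      assoc            : (p q r s : Obj) (u : Hom p q) (v : Hom q r)
                         (w : Hom r s) → (w ∘ v) ∘ u ≡ w ∘ (v ∘ u)
      ∘-preserves-⋁ˡ   : (p q r : Obj) (v : Hom q r) {I : Set}
                         (f : I → Hom p q) (x : Hom p q) →
                         IsLUB f x → IsLUB (λ i → v ∘ f i) (v ∘ x)
      ∘-preserves-⋁ʳ   : (p q r : Obj) (u : Hom p q) {I : Set}
                         (f : I → Hom q r) (x : Hom q r) →
                         IsLUB f x → IsLUB (λ i → f i ∘ u) (x ∘ u)

  IsBottom : {p q : Obj} → Hom p q → Set
  IsBottom {p} {q} b = (x : Hom p q) → b ≤ x

  NonTrivial : Set
  NonTrivial = (q : Obj) (b : Hom q q) → IsBottom b →
               (b ≤ id q) × ¬ (b ≡ id q)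

  -- left implication  w / u = x :  v ∘ u ≤ w ⇔ v ≤ x   (u : p→q, w : p→r)
  IsLeftImplication : (p q r : Obj) → Hom p q → Hom p r → Hom q r → Set
  IsLeftImplication p q r u w x = (v : Hom q r) → ((v ∘ u) ≤ w) ⇔ (v ≤ x)

  -- right implication  v \ w = x :  v ∘ u ≤ w ⇔ u ≤ x   (v : q→r, w : p→r)
  IsRightImplication : (p q r : Obj) → Hom q r → Hom p r → Hom p q → Set
  IsRightImplication p q r v w x = (u : Hom p q) → ((v ∘ u) ≤ w) ⇔ (u ≤ x)

data Obj3 : Set where
  m1 z p1 : Obj3

data Two : Set where
  ⊥₂ id₂ : Two

data _≤₂_ : Two → Two → Set where
  ⊥≤ : (x : Two) → ⊥₂ ≤₂ x
  id≤id : id₂ ≤₂ id₂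

_∧₂_ : Two → Two → Two
id₂ ∧₂ y = y
⊥₂ ∧₂ y = ⊥₂

module Q& {L₁ L₂ P : CompleteLattice} (T : AdjointTriple L₁ L₂ P) where
  open AdjointTriple T
  private
    module L₁ = CompleteLattice L₁
    module L₂ = CompleteLattice L₂
    module P  = CompleteLattice P

  Hom : Obj3 → Obj3 → Set
  Hom m1 m1 = Two
  Hom m1 z  = L₁.Carrier
  Hom m1 p1 = P.Carrier
  Hom z  m1 = ⊤
  Hom z  z  = Two
  Hom z  p1 = L₂.Carrier
  Hom p1 m1 = ⊤
  Hom p1 z  = ⊤
  Hom p1 p1 = Two

  Le : {p q : Obj3} → Hom p q → Hom p q → Set
  Le {m1} {m1} = _≤₂_
  Le {m1} {z}  = L₁._≤_
  Le {m1} {p1} = P._≤_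
  Le {z}  {m1} = λ _ _ → ⊤
  Le {z}  {z}  = _≤₂_
  Le {z}  {p1} = L₂._≤_
  Le {p1} {m1} = λ _ _ → ⊤
  Le {p1} {z}  = λ _ _ → ⊤
  Le {p1} {p1} = _≤₂_

  ident : (q : Obj3) → Hom q q
  ident m1 = id₂
  ident z  = id₂
  ident p1 = id₂

  -- u ⋆ a : u composed with an endomorphism a ∈ {⊥, id} (identity law or ⊥)
  scale : {A : Set} → A → Two → A → A
  scale ⊥A id₂ u = u
  scale ⊥A ⊥₂  u = ⊥A

  comp : {p q r : Obj3} → Hom q r → Hom p q → Hom p r
  comp {m1} {m1} {m1} v u = v ∧₂ u
  comp {m1} {m1} {z}  v u = scale L₁.bot u v
  comp {m1} {m1} {p1} v u = scale P.bot u v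
  comp {m1} {z}  {m1} v u = ⊥₂
  comp {m1} {z}  {z}  v u = scale L₁.bot v u
  comp {m1} {z}  {p1} v u = u & v
  comp {m1} {p1} {m1} v u = ⊥₂
  comp {m1} {p1} {z}  v u = L₁.bot
  comp {m1} {p1} {p1} v u = scale P.bot v u
  comp {z}  {m1} {m1} v u = tt
  comp {z}  {m1} {z}  v u = ⊥₂
  comp {z}  {m1} {p1} v u = L₂.bot
  comp {z}  {z}  {m1} v u = tt
  comp {z}  {z}  {z}  v u = v ∧₂ u
  comp {z}  {z}  {p1} v u = scale L₂.bot u v
  comp {z}  {p1} {m1} v u = tt
  comp {z}  {p1} {z}  v u = ⊥₂
  comp {z}  {p1} {p1} v u = scale L₂.bot v u
  comp {p1} {m1} {m1} v u = tt
  comp {p1} {m1} {z}  v u = tt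
  comp {p1} {m1} {p1} v u = ⊥₂
  comp {p1} {z}  {m1} v u = tt
  comp {p1} {z}  {z}  v u = tt
  comp {p1} {z}  {p1} v u = ⊥₂
  comp {p1} {p1} {m1} v u = tt
  comp {p1} {p1} {z}  v u = tt
  comp {p1} {p1} {p1} v u = v ∧₂ u

  𝒬 : QuantaloidData
  𝒬 = record { Obj = Obj3 ; Hom = Hom ; _≤_ = λ {p} {q} → Le {p} {q} ; id = ident ; _∘_ = λ {p} {q} {r} → comp {p} {q} {r} }

-- Apart from the composite L₁ × L₂ → P given by &, every composite in Q_& is an identity
-- law, a bottom, or the meet on the chain ⊥ < id, so the quantaloid laws come down to facts
-- about &: it preserves joins and is strict in each variable, both because it is a left
-- adjoint in each variable, and hence it commutes with scaling by ⊥ and id. The two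
-- implications are literally the two adjunctions of the triple. Excluded middle is needed
-- only for the completeness of the chain ⊥ < id: a family has join id exactly when some
-- member is id.

module Submission where

open import Defs
open import Level using (0ℓ)
open import Axiom.ExcludedMiddle using (ExcludedMiddle)
open import Data.Product using (Σ; ∃; _×_; _,_)
open import Data.Empty using (⊥-elim)
open import Data.Unit using (⊤; tt)
open import Relation.Nullary using (¬_; yes; no; contradiction)
open import Relation.Binary.Definitions using (Reflexive; Transitive; Minimum; Maximum)
open import Relation.Binary.PropositionalEquality
  using (_≡_; refl; sym; trans; subst; isEquivalence)
open import Relation.Binary.Structures using (IsPartialOrder)
open import Function.Bundles using (_⇔_; Equivalence)

IsLub : {A : Set} → (A → A → Set) → {I : Set} → (I → A) → A → Set
IsLub {A} _≤_ {I} f x = ((i : I) → f i ≤ x) × ((y : A) → ((i : I) → f i ≤ y) → x ≤ y)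

module _ {A : Set} {_≤_ : A → A → Set} where

  const-isLub : {b : A} → b ≤ b → Minimum _≤_ b → {I : Set} → IsLub _≤_ {I} (λ _ → b) b
  const-isLub b≤b b-min = (λ _ → b≤b) , (λ y _ → b-min y)

⊤-isPartialOrder : IsPartialOrder (_≡_ {A = ⊤}) (λ _ _ → ⊤)
⊤-isPartialOrder = record
  { isPreorder = record { isEquivalence = isEquivalence ; reflexive = λ _ → tt ; trans = λ _ _ → tt }
  ; antisym    = λ _ _ → refl
  }

⊤-isLub : {I : Set} (f : I → ⊤) (x : ⊤) → IsLub (λ _ _ → ⊤) f x
⊤-isLub _ _ = (λ _ → tt) , (λ _ _ → tt)

≤₂-refl : Reflexive _≤₂_
≤₂-refl {⊥₂} = ⊥≤ ⊥₂
≤₂-refl {id₂} = id≤id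

id₂-maximum : Maximum _≤₂_ id₂
id₂-maximum ⊥₂ = ⊥≤ id₂
id₂-maximum id₂ = id≤id

≤₂-isPartialOrder : IsPartialOrder _≡_ _≤₂_
≤₂-isPartialOrder = record
  { isPreorder = record
    { isEquivalence = isEquivalence
    ; reflexive     = λ { refl → ≤₂-refl }
    ; trans         = λ { (⊥≤ _) _ → ⊥≤ _ ; id≤id id≤id → id≤id }
    }
  ; antisym = λ { (⊥≤ ⊥₂) _ → refl ; id≤id _ → refl }
  }

minimum-<id₂ : (b : Two) → Minimum _≤₂_ b → (b ≤₂ id₂) × ¬ (b ≡ id₂)
minimum-<id₂ ⊥₂  _     = ⊥≤ id₂ , λ ()
minimum-<id₂ id₂ b-min with b-min ⊥₂
... | ()

∄id₂⇒≤⊥₂ : {I : Set} {f : I → Two} → ¬ ∃ (λ i → f i ≡ id₂) → (i : I) → f i ≤₂ ⊥₂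
∄id₂⇒≤⊥₂ {f = f} ∄ i with f i in eq
... | ⊥₂ = ⊥≤ ⊥₂
... | id₂ = contradiction (i , eq) ∄

∧₂-identityʳ : (a : Two) → a ∧₂ id₂ ≡ a
∧₂-identityʳ ⊥₂  = refl
∧₂-identityʳ id₂ = refl

∧₂-zeroʳ : (a : Two) → a ∧₂ ⊥₂ ≡ ⊥₂
∧₂-zeroʳ ⊥₂  = refl
∧₂-zeroʳ id₂ = refl

∧₂-assoc : (a b c : Two) → (a ∧₂ b) ∧₂ c ≡ a ∧₂ (b ∧₂ c)
∧₂-assoc ⊥₂  _ _ = refl
∧₂-assoc id₂ _ _ = refl

∧₂-isLubʳ : (a : Two) {I : Set} (f : I → Two) (x : Two) →
  IsLub _≤₂_ f x → IsLub _≤₂_ (λ i → a ∧₂ f i) (a ∧₂ x)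
∧₂-isLubʳ ⊥₂  _ _ _   = const-isLub {_≤_ = _≤₂_} (⊥≤ ⊥₂) ⊥≤
∧₂-isLubʳ id₂ _ _ lub = lub

module _ (em : ExcludedMiddle 0ℓ) where

  Two-complete : {I : Set} (f : I → Two) → Σ Two (IsLub _≤₂_ f)
  Two-complete f with em {∃ λ i → f i ≡ id₂}
  ... | yes (i , fi≡id₂) = id₂ , (λ j → id₂-maximum (f j)) , λ y f≤y → subst (_≤₂ y) fi≡id₂ (f≤y i)
  ... | no ∄ = ⊥₂ , ∄id₂⇒≤⊥₂ ∄ , λ y _ → ⊥≤ y

  id₂-isLub⇒∃id₂ : {I : Set} {f : I → Two} → IsLub _≤₂_ f id₂ → ∃ λ i → f i ≡ id₂
  id₂-isLub⇒∃id₂ {f = f} (_ , least) with em {∃ λ i → f i ≡ id₂}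
  ... | yes ∃id₂ = ∃id₂
  ... | no ∄ with least ⊥₂ (∄id₂⇒≤⊥₂ ∄)
  ...   | ()

  Two-map-preserves-isLub : {A : Set} {_≤_ : A → A → Set} (h : Two → A) →
    Reflexive _≤_ → Minimum _≤_ (h ⊥₂) →
    {I : Set} (f : I → Two) (x : Two) → IsLub _≤₂_ f x → IsLub _≤_ (λ i → h (f i)) (h x)
  Two-map-preserves-isLub {A} {_≤_} h ≤-refl h⊥-min {I} f x lub@(f≤x , _) =
    (λ i → mono (f≤x i)) , least x lub
    where
    mono : ∀ {a b} → a ≤₂ b → h a ≤ h b
    mono (⊥≤ b) = h⊥-min (h b)
    mono id≤id  = ≤-refl
    least : (x : Two) → IsLub _≤₂_ f x → (y : A) → ((i : I) → h (f i) ≤ y) → h x ≤ y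
    least ⊥₂  _   y _   = h⊥-min y
    least id₂ lub y h≤y with id₂-isLub⇒∃id₂ lub
    ... | i , fi≡id₂ = subst (λ a → h a ≤ y) fi≡id₂ (h≤y i)

  ∧₂-isLubˡ : (a : Two) {I : Set} (f : I → Two) (x : Two) →
    IsLub _≤₂_ f x → IsLub _≤₂_ (λ i → f i ∧₂ a) (x ∧₂ a)
  ∧₂-isLubˡ a = Two-map-preserves-isLub {_≤_ = _≤₂_} (_∧₂ a) ≤₂-refl ⊥≤

module _ (L : CompleteLattice) where
  open CompleteLattice L using (_≤_; ⋁; ⋁-upper; ⋁-least)

  bot-minimum : Minimum _≤_ (bot L)
  bot-minimum y = ⋁-least ⊥-elim y (λ ())

  ⋁-isLub : {I : Set} (f : I → Carrier L) → IsLub _≤_ f (⋁ f)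
  ⋁-isLub f = ⋁-upper f , ⋁-least f

left-adjoint-preserves-isLub : {A B : Set} {_≤A_ : A → A → Set} {_≤B_ : B → B → Set}
  (h : A → B) (g : B → A) → ((a : A) (b : B) → (h a ≤B b) ⇔ (a ≤A g b)) →
  Transitive _≤A_ → Reflexive _≤B_ →
  {I : Set} (f : I → A) (x : A) → IsLub _≤A_ f x → IsLub _≤B_ (λ i → h (f i)) (h x)
left-adjoint-preserves-isLub h g h⊣g ≤A-trans ≤B-refl f x (f≤x , least) =
  (λ i → from (h⊣g (f i) (h x)) (≤A-trans (f≤x i) (to (h⊣g x (h x)) ≤B-refl))) ,
  (λ y hf≤y → from (h⊣g x y) (least (g y) (λ i → to (h⊣g (f i) y) (hf≤y i))))
  where open Equivalence

module _ {L₁ L₂ P : CompleteLattice} (T : AdjointTriple L₁ L₂ P) where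
  open AdjointTriple T
  open Equivalence
  private
    module L₁ = CompleteLattice L₁
    module L₂ = CompleteLattice L₂
    module P  = CompleteLattice P
    module ≤₁ = IsPartialOrder L₁.isPartialOrder
    module ≤₂ = IsPartialOrder L₂.isPartialOrder
    module ≤P = IsPartialOrder P.isPartialOrder

  &-zeroˡ : (y : Carrier L₂) → bot L₁ & y ≡ bot P
  &-zeroˡ y = ≤P.antisym (from (adj↙ (bot L₁) y (bot P)) (bot-minimum L₁ _)) (bot-minimum P _)

  &-zeroʳ : (x : Carrier L₁) → x & bot L₂ ≡ bot P
  &-zeroʳ x = ≤P.antisym (from (adj↖ x (bot L₂) (bot P)) (bot-minimum L₂ _)) (bot-minimum P _)

  &-isLubˡ : (y : Carrier L₂) {I : Set} (f : I → Carrier L₁) (x : Carrier L₁) →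
    IsLub L₁._≤_ f x → IsLub P._≤_ (λ i → f i & y) (x & y)
  &-isLubˡ y = left-adjoint-preserves-isLub {_≤A_ = L₁._≤_} {_≤B_ = P._≤_}
    (_& y) (_↙ y) (λ a b → adj↙ a y b) ≤₁.trans ≤P.refl

  &-isLubʳ : (x : Carrier L₁) {I : Set} (f : I → Carrier L₂) (y : Carrier L₂) →
    IsLub L₂._≤_ f y → IsLub P._≤_ (λ i → x & f i) (x & y)
  &-isLubʳ x = left-adjoint-preserves-isLub {_≤A_ = L₂._≤_} {_≤B_ = P._≤_}
    (x &_) (_↖ x) (adj↖ x) ≤₂.trans ≤P.refl

module _ {L₁ L₂ P : CompleteLattice} (T : AdjointTriple L₁ L₂ P) where
  open Q& T
  open AdjointTriple T using (_&_)

  module _ {A : Set} (b : A) where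

    scale-bot : (a : Two) → scale b a b ≡ b
    scale-bot ⊥₂  = refl
    scale-bot id₂ = refl

    scale-∧ : (a a′ : Two) (x : A) → scale b (a ∧₂ a′) x ≡ scale b a (scale b a′ x)
    scale-∧ ⊥₂  _ _ = refl
    scale-∧ id₂ _ _ = refl

    scale-comm : (a a′ : Two) (x : A) → scale b a (scale b a′ x) ≡ scale b a′ (scale b a x)
    scale-comm ⊥₂  ⊥₂  _ = refl
    scale-comm ⊥₂  id₂ _ = refl
    scale-comm id₂ _   _ = refl

    scale-∧-flip : (a a′ : Two) (x : A) → scale b a (scale b a′ x) ≡ scale b (a′ ∧₂ a) x
    scale-∧-flip a a′ x = trans (scale-comm a a′ x) (sym (scale-∧ a′ a x))

  scale-&ˡ : (a : Two) (x : Carrier L₁) (y : Carrier L₂) →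
    scale (bot P) a (x & y) ≡ scale (bot L₁) a x & y
  scale-&ˡ ⊥₂  _ y = sym (&-zeroˡ T y)
  scale-&ˡ id₂ _ _ = refl

  scale-&ʳ : (a : Two) (x : Carrier L₁) (y : Carrier L₂) →
    scale (bot P) a (x & y) ≡ x & scale (bot L₂) a y
  scale-&ʳ ⊥₂  x _ = sym (&-zeroʳ T x)
  scale-&ʳ id₂ _ _ = refl

  ∘-assoc : (p q r s : Obj3) (u : Hom p q) (v : Hom q r) (w : Hom r s) →
    comp {p} {q} {s} (comp {q} {r} {s} w v) u ≡ comp {p} {r} {s} w (comp {p} {q} {r} v u)
  -- a source above the target has the one-element hom-set ⊤, where η decides
  ∘-assoc z  _  _  m1 _ _ _ = refl
  ∘-assoc p1 _  _  m1 _ _ _ = refl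
  ∘-assoc p1 _  _  z  _ _ _ = refl
  ∘-assoc m1 m1 m1 m1 u v w = ∧₂-assoc w v u
  ∘-assoc m1 m1 z  m1 _ _ _ = refl
  ∘-assoc m1 m1 p1 m1 _ _ _ = refl
  ∘-assoc m1 z  m1 m1 _ _ w = sym (∧₂-zeroʳ w)
  ∘-assoc m1 z  z  m1 _ _ _ = refl
  ∘-assoc m1 z  p1 m1 _ _ _ = refl
  ∘-assoc m1 p1 m1 m1 _ _ w = sym (∧₂-zeroʳ w)
  ∘-assoc m1 p1 z  m1 _ _ _ = refl
  ∘-assoc m1 p1 p1 m1 _ _ _ = refl
  ∘-assoc m1 m1 m1 z  u v w = scale-∧-flip _ u v w
  ∘-assoc m1 m1 z  z  u v w = scale-comm _ u w v
  ∘-assoc m1 m1 p1 z  u _ _ = scale-bot _ u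
  ∘-assoc m1 z  m1 z  _ _ _ = refl
  ∘-assoc m1 z  z  z  u v w = scale-∧ _ w v u
  ∘-assoc m1 z  p1 z  _ _ _ = refl
  ∘-assoc m1 p1 m1 z  _ _ _ = refl
  ∘-assoc m1 p1 z  z  _ _ w = sym (scale-bot _ w)
  ∘-assoc m1 p1 p1 z  _ _ _ = refl
  ∘-assoc m1 m1 m1 p1 u v w = scale-∧-flip _ u v w
  ∘-assoc m1 m1 z  p1 u v w = scale-&ˡ u v w
  ∘-assoc m1 m1 p1 p1 u v w = scale-comm _ u w v
  ∘-assoc m1 z  m1 p1 u _ _ = &-zeroʳ T u
  ∘-assoc m1 z  z  p1 u v w = trans (sym (scale-&ʳ v u w)) (scale-&ˡ v u w)
  ∘-assoc m1 z  p1 p1 u v w = sym (scale-&ʳ w u v)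
  ∘-assoc m1 p1 m1 p1 _ _ _ = refl
  ∘-assoc m1 p1 z  p1 _ _ w = sym (&-zeroˡ T w)
  ∘-assoc m1 p1 p1 p1 u v w = scale-∧ _ w v u
  ∘-assoc z  m1 m1 z  _ _ _ = refl
  ∘-assoc z  m1 z  z  _ _ w = sym (∧₂-zeroʳ w)
  ∘-assoc z  m1 p1 z  _ _ _ = refl
  ∘-assoc z  z  m1 z  _ _ _ = refl
  ∘-assoc z  z  z  z  u v w = ∧₂-assoc w v u
  ∘-assoc z  z  p1 z  _ _ _ = refl
  ∘-assoc z  p1 m1 z  _ _ _ = refl
  ∘-assoc z  p1 z  z  _ _ w = sym (∧₂-zeroʳ w)
  ∘-assoc z  p1 p1 z  _ _ _ = refl
  ∘-assoc z  m1 m1 p1 _ _ _ = refl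
  ∘-assoc z  m1 z  p1 _ _ _ = refl
  ∘-assoc z  m1 p1 p1 _ _ w = sym (scale-bot _ w)
  ∘-assoc z  z  m1 p1 u _ _ = scale-bot _ u
  ∘-assoc z  z  z  p1 u v w = scale-∧-flip _ u v w
  ∘-assoc z  z  p1 p1 u v w = scale-comm _ u w v
  ∘-assoc z  p1 m1 p1 _ _ _ = refl
  ∘-assoc z  p1 z  p1 _ _ _ = refl
  ∘-assoc z  p1 p1 p1 u v w = scale-∧ _ w v u
  ∘-assoc p1 m1 m1 p1 _ _ _ = refl
  ∘-assoc p1 m1 z  p1 _ _ _ = refl
  ∘-assoc p1 m1 p1 p1 _ _ w = sym (∧₂-zeroʳ w)
  ∘-assoc p1 z  m1 p1 _ _ _ = refl
  ∘-assoc p1 z  z  p1 _ _ _ = refl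
  ∘-assoc p1 z  p1 p1 _ _ w = sym (∧₂-zeroʳ w)
  ∘-assoc p1 p1 m1 p1 _ _ _ = refl
  ∘-assoc p1 p1 z  p1 _ _ _ = refl
  ∘-assoc p1 p1 p1 p1 u v w = ∧₂-assoc w v u

  ∘-identityˡ : (p q : Obj3) (u : Hom p q) → comp {p} {q} {q} (ident q) u ≡ u
  ∘-identityˡ m1 m1 _ = refl
  ∘-identityˡ m1 z  _ = refl
  ∘-identityˡ m1 p1 _ = refl
  ∘-identityˡ z  m1 _ = refl
  ∘-identityˡ z  z  _ = refl
  ∘-identityˡ z  p1 _ = refl
  ∘-identityˡ p1 m1 _ = refl
  ∘-identityˡ p1 z  _ = refl
  ∘-identityˡ p1 p1 _ = refl

  ∘-identityʳ : (p q : Obj3) (u : Hom p q) → comp {p} {p} {q} u (ident p) ≡ u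
  ∘-identityʳ m1 m1 u = ∧₂-identityʳ u
  ∘-identityʳ m1 z  _ = refl
  ∘-identityʳ m1 p1 _ = refl
  ∘-identityʳ z  m1 _ = refl
  ∘-identityʳ z  z  u = ∧₂-identityʳ u
  ∘-identityʳ z  p1 _ = refl
  ∘-identityʳ p1 m1 _ = refl
  ∘-identityʳ p1 z  _ = refl
  ∘-identityʳ p1 p1 u = ∧₂-identityʳ u

  Le-isPartialOrder : (p q : Obj3) → IsPartialOrder _≡_ (Le {p} {q})
  Le-isPartialOrder m1 m1 = ≤₂-isPartialOrder
  Le-isPartialOrder m1 z  = CompleteLattice.isPartialOrder L₁
  Le-isPartialOrder m1 p1 = CompleteLattice.isPartialOrder P
  Le-isPartialOrder z  m1 = ⊤-isPartialOrder
  Le-isPartialOrder z  z  = ≤₂-isPartialOrder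
  Le-isPartialOrder z  p1 = CompleteLattice.isPartialOrder L₂
  Le-isPartialOrder p1 m1 = ⊤-isPartialOrder
  Le-isPartialOrder p1 z  = ⊤-isPartialOrder
  Le-isPartialOrder p1 p1 = ≤₂-isPartialOrder

  Le-refl : (p q : Obj3) → Reflexive (Le {p} {q})
  Le-refl p q = IsPartialOrder.refl (Le-isPartialOrder p q)

  ⊥Hom : (p q : Obj3) → Hom p q
  ⊥Hom m1 m1 = ⊥₂
  ⊥Hom m1 z  = bot L₁
  ⊥Hom m1 p1 = bot P
  ⊥Hom z  m1 = tt
  ⊥Hom z  z  = ⊥₂
  ⊥Hom z  p1 = bot L₂
  ⊥Hom p1 m1 = tt
  ⊥Hom p1 z  = tt
  ⊥Hom p1 p1 = ⊥₂

  ⊥Hom-minimum : (p q : Obj3) → Minimum (Le {p} {q}) (⊥Hom p q)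
  ⊥Hom-minimum m1 m1 = ⊥≤
  ⊥Hom-minimum m1 z  = bot-minimum L₁
  ⊥Hom-minimum m1 p1 = bot-minimum P
  ⊥Hom-minimum z  m1 = λ _ → tt
  ⊥Hom-minimum z  z  = ⊥≤
  ⊥Hom-minimum z  p1 = bot-minimum L₂
  ⊥Hom-minimum p1 m1 = λ _ → tt
  ⊥Hom-minimum p1 z  = λ _ → tt
  ⊥Hom-minimum p1 p1 = ⊥≤

  ⊥Hom-isLub : (p q : Obj3) {I : Set} → IsLub (Le {p} {q}) {I} (λ _ → ⊥Hom p q) (⊥Hom p q)
  ⊥Hom-isLub p q = const-isLub {_≤_ = Le {p} {q}} (Le-refl p q) (⊥Hom-minimum p q)

  scale-isLubʳ : (p q : Obj3) (a : Two) {I : Set} (f : I → Hom p q) (x : Hom p q) →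
    IsLub (Le {p} {q}) f x →
    IsLub (Le {p} {q}) (λ i → scale (⊥Hom p q) a (f i)) (scale (⊥Hom p q) a x)
  scale-isLubʳ p q ⊥₂  _ _ _   = ⊥Hom-isLub p q
  scale-isLubʳ _ _ id₂ _ _ lub = lub

  𝒬-nonTrivial : NonTrivial 𝒬
  𝒬-nonTrivial m1 = minimum-<id₂
  𝒬-nonTrivial z  = minimum-<id₂
  𝒬-nonTrivial p1 = minimum-<id₂

  module _ (em : ExcludedMiddle 0ℓ) where

    Hom-complete : (p q : Obj3) {I : Set} (f : I → Hom p q) →
      Σ (Hom p q) (IsLub (Le {p} {q}) f)
    Hom-complete m1 m1 f = Two-complete em f
    Hom-complete m1 z  f = _ , ⋁-isLub L₁ f
    Hom-complete m1 p1 f = _ , ⋁-isLub P f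
    Hom-complete z  m1 f = tt , ⊤-isLub f tt
    Hom-complete z  z  f = Two-complete em f
    Hom-complete z  p1 f = _ , ⋁-isLub L₂ f
    Hom-complete p1 m1 f = tt , ⊤-isLub f tt
    Hom-complete p1 z  f = tt , ⊤-isLub f tt
    Hom-complete p1 p1 f = Two-complete em f

    scale-isLubˡ : (p q : Obj3) (u : Hom p q) {I : Set} (f : I → Two) (x : Two) →
      IsLub _≤₂_ f x →
      IsLub (Le {p} {q}) (λ i → scale (⊥Hom p q) (f i) u) (scale (⊥Hom p q) x u)
    scale-isLubˡ p q u = Two-map-preserves-isLub em {_≤_ = Le {p} {q}}
      (λ a → scale (⊥Hom p q) a u) (Le-refl p q) (⊥Hom-minimum p q)

    ∘-isLubˡ : (p q r : Obj3) (v : Hom q r) {I : Set} (f : I → Hom p q) (x : Hom p q) →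
      IsLub (Le {p} {q}) f x →
      IsLub (Le {p} {r}) (λ i → comp {p} {q} {r} v (f i)) (comp {p} {q} {r} v x)
    ∘-isLubˡ m1 m1 m1 v = ∧₂-isLubʳ v
    ∘-isLubˡ m1 m1 z  v = scale-isLubˡ m1 z v
    ∘-isLubˡ m1 m1 p1 v = scale-isLubˡ m1 p1 v
    ∘-isLubˡ m1 z  m1 _ _ _ _ = ⊥Hom-isLub m1 m1
    ∘-isLubˡ m1 z  z  v = scale-isLubʳ m1 z v
    ∘-isLubˡ m1 z  p1 v = &-isLubˡ T v
    ∘-isLubˡ m1 p1 m1 _ _ _ _ = ⊥Hom-isLub m1 m1
    ∘-isLubˡ m1 p1 z  _ _ _ _ = ⊥Hom-isLub m1 z
    ∘-isLubˡ m1 p1 p1 v = scale-isLubʳ m1 p1 v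
    ∘-isLubˡ z  _  m1 _ _ _ _ = ⊤-isLub _ _
    ∘-isLubˡ z  m1 z  _ _ _ _ = ⊥Hom-isLub z z
    ∘-isLubˡ z  m1 p1 _ _ _ _ = ⊥Hom-isLub z p1
    ∘-isLubˡ z  z  z  v = ∧₂-isLubʳ v
    ∘-isLubˡ z  z  p1 v = scale-isLubˡ z p1 v
    ∘-isLubˡ z  p1 z  _ _ _ _ = ⊥Hom-isLub z z
    ∘-isLubˡ z  p1 p1 v = scale-isLubʳ z p1 v
    ∘-isLubˡ p1 _  m1 _ _ _ _ = ⊤-isLub _ _
    ∘-isLubˡ p1 _  z  _ _ _ _ = ⊤-isLub _ _
    ∘-isLubˡ p1 m1 p1 _ _ _ _ = ⊥Hom-isLub p1 p1
    ∘-isLubˡ p1 z  p1 _ _ _ _ = ⊥Hom-isLub p1 p1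
    ∘-isLubˡ p1 p1 p1 v = ∧₂-isLubʳ v

    ∘-isLubʳ : (p q r : Obj3) (u : Hom p q) {I : Set} (f : I → Hom q r) (x : Hom q r) →
      IsLub (Le {q} {r}) f x →
      IsLub (Le {p} {r}) (λ i → comp {p} {q} {r} (f i) u) (comp {p} {q} {r} x u)
    ∘-isLubʳ m1 m1 m1 u = ∧₂-isLubˡ em u
    ∘-isLubʳ m1 m1 z  u = scale-isLubʳ m1 z u
    ∘-isLubʳ m1 m1 p1 u = scale-isLubʳ m1 p1 u
    ∘-isLubʳ m1 z  m1 _ _ _ _ = ⊥Hom-isLub m1 m1
    ∘-isLubʳ m1 z  z  u = scale-isLubˡ m1 z u
    ∘-isLubʳ m1 z  p1 u = &-isLubʳ T u
    ∘-isLubʳ m1 p1 m1 _ _ _ _ = ⊥Hom-isLub m1 m1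
    ∘-isLubʳ m1 p1 z  _ _ _ _ = ⊥Hom-isLub m1 z
    ∘-isLubʳ m1 p1 p1 u = scale-isLubˡ m1 p1 u
    ∘-isLubʳ z  _  m1 _ _ _ _ = ⊤-isLub _ _
    ∘-isLubʳ z  m1 z  _ _ _ _ = ⊥Hom-isLub z z
    ∘-isLubʳ z  m1 p1 _ _ _ _ = ⊥Hom-isLub z p1
    ∘-isLubʳ z  z  z  u = ∧₂-isLubˡ em u
    ∘-isLubʳ z  z  p1 u = scale-isLubʳ z p1 u
    ∘-isLubʳ z  p1 z  _ _ _ _ = ⊥Hom-isLub z z
    ∘-isLubʳ z  p1 p1 u = scale-isLubˡ z p1 u
    ∘-isLubʳ p1 _  m1 _ _ _ _ = ⊤-isLub _ _
    ∘-isLubʳ p1 _  z  _ _ _ _ = ⊤-isLub _ _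
    ∘-isLubʳ p1 m1 p1 _ _ _ _ = ⊥Hom-isLub p1 p1
    ∘-isLubʳ p1 z  p1 _ _ _ _ = ⊥Hom-isLub p1 p1
    ∘-isLubʳ p1 p1 p1 u = ∧₂-isLubˡ em u

    𝒬-isQuantaloid : IsQuantaloid 𝒬
    𝒬-isQuantaloid = record
      { hom-partialOrder = Le-isPartialOrder
      ; hom-complete     = Hom-complete
      ; identityˡ        = ∘-identityˡ
      ; identityʳ        = ∘-identityʳ
      ; assoc            = ∘-assoc
      ; ∘-preserves-⋁ˡ   = ∘-isLubˡ
      ; ∘-preserves-⋁ʳ   = ∘-isLubʳ
      }

proposition3p1 : ExcludedMiddle 0ℓ →
    (L₁ L₂ P : CompleteLattice) (T : AdjointTriple L₁ L₂ P) →
    IsQuantaloid (Q&.𝒬 T)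
    × NonTrivial (Q&.𝒬 T)
    × ((u : Carrier L₁) (w : Carrier P) →
         IsLeftImplication (Q&.𝒬 T) m1 z p1 u w (AdjointTriple._↖_ T w u))
    × ((v : Carrier L₂) (w : Carrier P) →
         IsRightImplication (Q&.𝒬 T) m1 z p1 v w (AdjointTriple._↙_ T w v))
proposition3p1 em L₁ L₂ P T =
  𝒬-isQuantaloid T em ,
  𝒬-nonTrivial T ,
  (λ u w v → adj↖ u v w) ,
  (λ v w u → adj↙ u v w)
  where open AdjointTriple T
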